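{- Let $F_1,\dots,F_k$ be a $k$-MOFS$(n)$ and let $\emptyset\ne C\subseteq N(n)\times N(n)$. For $1\le i\le k$ let $C_i=C$ if $F_i$ agrees with $F_1$ on every cell of $C$ or disagrees with $F_1$ on every cell of $C$, and let $C_i=\emptyset$ otherwise. For $1\le i\le k$ and $a\in\{0,1\}$ let $V_{i,a}=\{(x,y)\in C: F_i[x,y]=a\}$. Then $T=(C_1,\dots,C_k)$ is a trade if and only if both of the following hold: (1) each row and each column of $F_1$ contains equally many zeros and ones among its cells that lie in $C$; (2) for each $j$ with $C_j=\emptyset$, $|V_{1,1}\cap V_{j,1}|=|V_{1,0}\cap V_{j,1}|$.
   Context: Let $N(n)=\{1,\dots,n\}$ and let $n$ be even. A (binary) frequency square of order $n$ is an $n\times n$ array indexed by $N(n)\times N(n)$ with entries in $\{0,1\}$ such that every row and every column contains exactly $n/2$ zeros and $n/2$ ones. Two frequency squares $F,G$ of order $n$ are orthogonal if for each $(a,b)\in\{0,1\}^2$ the number of cells $(r,c)$ with $(F[r,c],G[r,c])=(a,b)$ equals $n^2/4$. A $k$-MOFS$(n)$ is an ordered set $F_1,\dots,F_k$ of pairwise orthogonal frequency squares of order $n$. For such a set, a tuple $(C_1,\dots,C_k)$ of subsets of $N(n)\times N(n)$, not all empty, is switched by replacing $F_i[x,y]$ with $1-F_i[x,y]$ for every $(x,y)\in C_i$, for each $i$; the tuple is a trade if the result of switching is again a $k$-MOFS$(n)$. -}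

module Defs where

open import Data.Nat using (ℕ; suc; _*_)
open import Data.Nat.DivMod using (_/_)
open import Data.Bool using (Bool; true; false; if_then_else_; not; _∧_; _∨_; _xor_)
open import Data.Bool.Properties using () renaming (_≟_ to _≟ᵇ_)
open import Data.Fin using (Fin; zero)
open import Data.List using (List; map; allFin)
open import Data.Nat.ListAction using (sum)
open import Data.Bool.ListAction using (all)
open import Data.Product using (_×_; ∃₂)
open import Relation.Binary.PropositionalEquality using (_≡_; _≢_)
open import Relation.Nullary.Decidable using (⌊_⌋)

-- Cells of an n×n array are pairs (row, column) in Fin n × Fin n
-- (Fin n = {0,…,n-1} plays the role of N(n)).
-- A binary array: entry 1 is represented by true, 0 by false.
Array : ℕ → Set
Array n = Fin n → Fin n → Bool

CellSet : ℕ → Set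
CellSet n = Fin n → Fin n → Bool

countB : ∀ {n} → (Fin n → Bool) → ℕ
countB {n} p = sum (map (λ i → if p i then 1 else 0) (allFin n))

countCells : ∀ {n} → (Fin n → Fin n → Bool) → ℕ
countCells {n} p = sum (map (λ x → countB (p x)) (allFin n))

_==_ : Bool → Bool → Bool
a == b = ⌊ a ≟ᵇ b ⌋

IsFrequencySquare : ∀ n → Array n → Set
IsFrequencySquare n F =
  (∀ x → countB (λ y → not (F x y)) ≡ n / 2 × countB (λ y → F x y) ≡ n / 2) ×
  (∀ y → countB (λ x → not (F x y)) ≡ n / 2 × countB (λ x → F x y) ≡ n / 2)

Orthogonal : ∀ n → Array n → Array n → Set
Orthogonal n F G =
  ∀ (a b : Bool) → countCells (λ x y → (F x y == a) ∧ (G x y == b)) ≡ (n * n) / 4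

IsMOFS : ∀ k n → (Fin k → Array n) → Set
IsMOFS k n F = (∀ i → IsFrequencySquare n (F i)) × (∀ i j → i ≢ j → Orthogonal n (F i) (F j))

∅ : ∀ {n} → CellSet n
∅ x y = false

IsEmpty : ∀ {n} → CellSet n → Set
IsEmpty C = ∀ x y → C x y ≡ false

switch : ∀ {k n} → (Fin k → Array n) → (Fin k → CellSet n) → Fin k → Array n
switch F Cs i x y = F i x y xor Cs i x y

IsTrade : ∀ k n → (Fin k → Array n) → (Fin k → CellSet n) → Set
IsTrade k n F Cs = (¬all-empty) × IsMOFS k n (switch F Cs)
  where
    open import Relation.Nullary using (¬_)
    ¬all-empty = ¬ (∀ i → IsEmpty (Cs i))

allCells : ∀ n → List (Fin n × Fin n)
allCells n = Data.List.concatMap (λ x → map (λ y → x Data.Product., y) (allFin n)) (allFin n)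
  where import Data.List; import Data.Product

agreesOn : ∀ {n} → CellSet n → Array n → Array n → Bool
agreesOn {n} C F G = all (λ { (x Data.Product., y) → not (C x y) ∨ (F x y == G x y) }) (allCells n)
  where import Data.Product

disagreesOn : ∀ {n} → CellSet n → Array n → Array n → Bool
disagreesOn {n} C F G = all (λ { (x Data.Product., y) → not (C x y) ∨ not (F x y == G x y) }) (allCells n)
  where import Data.Product

-- the tuple (C_1,…,C_k) built from C, with F_1 = F zero:
-- C_i = C if F_i agrees with F_1 on all of C or disagrees on all of C, else ∅
inducedTuple : ∀ {k n} → (Fin (suc k) → Array n) → CellSet n → Fin (suc k) → CellSet n
inducedTuple F C i =
  if agreesOn C (F i) (F zero) ∨ disagreesOn C (F i) (F zero) then C else ∅

V : ∀ {k n} → (Fin k → Array n) → CellSet n → Fin k → Bool → CellSet n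
V F C i a x y = C x y ∧ (F i x y == a)

Cond1 : ∀ {k n} → (Fin (suc k) → Array n) → CellSet n → Set
Cond1 F C =
  (∀ x → countB (λ y → V F C zero false x y) ≡ countB (λ y → V F C zero true x y)) ×
  (∀ y → countB (λ x → V F C zero false x y) ≡ countB (λ x → V F C zero true x y))

Cond2 : ∀ {k n} → (Fin (suc k) → Array n) → CellSet n → Set
Cond2 F C = ∀ j → IsEmpty (inducedTuple F C j) →
  countCells (λ x y → V F C zero true x y ∧ V F C j true x y)
    ≡ countCells (λ x y → V F C zero false x y ∧ V F C j true x y)

module Submission where

-- Switching F_i on C leaves every line count and every pair count unchanged outside C and, inside C,
-- replaces the values by their complements; so such a count is preserved iff its part inside C is
-- invariant under complementation. On C each switched square is F_1 or its complement, and such an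
-- invariance holds for F_1 as soon as F_1 takes the values 0 and 1 equally often on the relevant
-- part of C: on each line of C for the frequency conditions (condition (1)), on all of C (the sum of
-- (1) over the rows) for two switched squares, and, for a switched and an unswitched square F_j, on
-- the parts of C where F_j is 1 (condition (2)) and where F_j is 0 (the difference of the previous two).

open import Defs
open import Algebra.Properties.CommutativeSemigroup using (interchange)
open import Data.Bool using (Bool; true; false; not; _∧_; _∨_; _xor_; if_then_else_; T; _≟_)
open import Data.Bool.ListAction using (all)
open import Data.Bool.Properties
  using (xor-identityʳ; xor-comm; not-distribʳ-xor; ∧-comm; ∧-conicalˡ; ∨-zeroʳ; ¬-not; T-≡)
open import Data.Empty using (⊥)
open import Data.Fin using (Fin; zero)
open import Data.List using (List; []; _∷_; map; allFin)
open import Data.List.Membership.Propositional using (_∈_)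
open import Data.List.Membership.Propositional.Properties using (∈-allFin; ∈-map⁺; ∈-concatMap⁺)
open import Data.List.Properties using (map-cong)
import Data.List.Relation.Unary.All as All
open import Data.List.Relation.Unary.All.Properties using (all⁺; all⁻)
import Data.List.Relation.Unary.Any as Any
open import Data.Nat using (ℕ; suc; _+_)
open import Data.Nat.Divisibility using (_∣_)
open import Data.Nat.ListAction using (sum)
open import Data.Nat.Properties using (+-identityʳ; +-cancelˡ-≡; +-commutativeSemigroup)
open import Data.Product using (_×_; ∃; ∃₂; _,_; uncurry)
open import Data.Sum using (_⊎_; inj₁; inj₂)
open import Function.Bundles using (_⇔_; mk⇔; Equivalence)
open import Relation.Binary.PropositionalEquality
  using (_≡_; _≢_; refl; sym; trans; cong; cong₂; subst; module ≡-Reasoning)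
open import Relation.Nullary using (¬_; yes; no)
open import Relation.Nullary.Decidable using (toWitness; toWitnessFalse)

open Equivalence using (to; from)
open ≡-Reasoning

ind : Bool → ℕ
ind b = if b then 1 else 0

cancel-common-summand : ∀ {m n} x {a b} → m ≡ x + a → n ≡ x + b → (m ≡ n ⇔ a ≡ b)
cancel-common-summand x m≡x+a n≡x+b = mk⇔
  (λ m≡n → +-cancelˡ-≡ x _ _ (trans (sym m≡x+a) (trans m≡n n≡x+b)))
  (λ a≡b → trans m≡x+a (trans (cong (x +_) a≡b) (sym n≡x+b)))

∧-cong-on : ∀ c {p q} → (c ≡ true → p ≡ q) → c ∧ p ≡ c ∧ q
∧-cong-on false _ = refl
∧-cong-on true  h = h refl

∧-regroup : ∀ c r s → c ∧ (r ∧ s) ≡ (c ∧ s) ∧ r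
∧-regroup false r s = refl
∧-regroup true  r s = ∧-comm r s

∧-shared-regroup : ∀ c p q → (c ∧ p) ∧ (c ∧ q) ≡ (c ∧ q) ∧ p
∧-shared-regroup false p q = refl
∧-shared-regroup true  p q = ∧-comm p q

==-refl : ∀ p → (p == p) ≡ true
==-refl false = refl
==-refl true  = refl

==-true : ∀ p → (p == true) ≡ p
==-true false = refl
==-true true  = refl

==-false : ∀ p → (p == false) ≡ not p
==-false false = refl
==-false true  = refl

not-== : ∀ p u → (not p == u) ≡ (p == not u)
not-== false false = refl
not-== false true  = refl
not-== true  false = refl
not-== true  true  = refl

bool-function-cases : (ψ : Bool → Bool) → (∀ b → ψ (not b) ≡ ψ b) ⊎ ∃ λ t → ∀ b → ψ b ≡ (b == t)
bool-function-cases ψ with ψ true in ψt | ψ false in ψf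
... | true  | true  = inj₁ λ { true → trans ψf (sym ψt) ; false → trans ψt (sym ψf) }
... | false | false = inj₁ λ { true → trans ψf (sym ψt) ; false → trans ψt (sym ψf) }
... | true  | false = inj₂ (true  , λ { true → ψt ; false → ψf })
... | false | true  = inj₂ (false , λ { true → ψt ; false → ψf })

ind-partition : ∀ c b → ind b ≡ ind (not c ∧ b) + ind (c ∧ b)
ind-partition false b = sym (+-identityʳ (ind b))
ind-partition true  b = refl

ind-switch : ∀ c (φ : Bool → Bool → Bool) p q →
  ind (φ (p xor c) (q xor c)) ≡ ind (not c ∧ φ p q) + ind (c ∧ φ (not p) (not q))
ind-switch false φ p q rewrite xor-identityʳ p | xor-identityʳ q = sym (+-identityʳ _)
ind-switch true  φ p q rewrite xor-comm p true | xor-comm q true = refl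

ind-fibres : ∀ m q (ψ : Bool → Bool) →
  ind (m ∧ ψ q) ≡ ind ((m ∧ (q == true)) ∧ ψ true) + ind ((m ∧ (q == false)) ∧ ψ false)
ind-fibres false q     ψ = refl
ind-fibres true  true  ψ = sym (+-identityʳ _)
ind-fibres true  false ψ = refl

sum-map-+ : {A : Set} (f g : A → ℕ) (xs : List A) →
  sum (map (λ x → f x + g x) xs) ≡ sum (map f xs) + sum (map g xs)
sum-map-+ f g []       = refl
sum-map-+ f g (x ∷ xs) =
  trans (cong (f x + g x +_) (sum-map-+ f g xs)) (interchange +-commutativeSemigroup (f x) (g x) _ _)

sum-map-split : {A : Set} {f g h : A → ℕ} (xs : List A) → (∀ x → f x ≡ g x + h x) →
  sum (map f xs) ≡ sum (map g xs) + sum (map h xs)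
sum-map-split {g = g} {h} xs f≡g+h = trans (cong sum (map-cong f≡g+h xs)) (sum-map-+ g h xs)

module _ {n : ℕ} where

  countB-cong : {p q : Fin n → Bool} → (∀ i → p i ≡ q i) → countB p ≡ countB q
  countB-cong p≗q = cong sum (map-cong (λ i → cong ind (p≗q i)) (allFin n))

  countB-split : {p q r : Fin n → Bool} → (∀ i → ind (p i) ≡ ind (q i) + ind (r i)) →
    countB p ≡ countB q + countB r
  countB-split = sum-map-split (allFin n)

  countCells-cong : {p q : Fin n × Fin n → Bool} → (∀ z → p z ≡ q z) →
    countCells (λ x y → p (x , y)) ≡ countCells (λ x y → q (x , y))
  countCells-cong p≗q = cong sum (map-cong (λ x → countB-cong (λ y → p≗q (x , y))) (allFin n))

  countCells-split : {p q r : Fin n × Fin n → Bool} → (∀ z → ind (p z) ≡ ind (q z) + ind (r z)) →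
    countCells (λ x y → p (x , y)) ≡ countCells (λ x y → q (x , y)) + countCells (λ x y → r (x , y))
  countCells-split p≡q+r = sum-map-split (allFin n) (λ x → countB-split (λ y → p≡q+r (x , y)))

module Counting {I : Set} (count : (I → Bool) → ℕ)
  (count-cong : ∀ {p q} → (∀ i → p i ≡ q i) → count p ≡ count q)
  (count-split : ∀ {p q r} → (∀ i → ind (p i) ≡ ind (q i) + ind (r i)) → count p ≡ count q + count r)
  where

  record Balanced (M P : I → Bool) : Set where
    constructor balanced
    field
      balance : count (λ i → M i ∧ (P i == false)) ≡ count (λ i → M i ∧ (P i == true))

  record Aligned (M P R : I → Bool) (d : Bool) : Set where
    constructor aligned
    field
      on-mask : ∀ i → M i ≡ true → P i ≡ d xor R i

  open Balanced public
  open Aligned public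

  Frequency : ℕ → (I → Bool) → Set
  Frequency m P = count (λ i → not (P i)) ≡ m × count P ≡ m

  count-cong-on : (M : I → Bool) {p q : I → Bool} → (∀ i → M i ≡ true → p i ≡ q i) →
    count (λ i → M i ∧ p i) ≡ count (λ i → M i ∧ q i)
  count-cong-on M p≗q = count-cong (λ i → ∧-cong-on (M i) (p≗q i))

  count-fibres : (M Q : I → Bool) (ψ : I → Bool → Bool) →
    count (λ i → M i ∧ ψ i (Q i)) ≡
    count (λ i → (M i ∧ (Q i == true)) ∧ ψ i true) + count (λ i → (M i ∧ (Q i == false)) ∧ ψ i false)
  count-fibres M Q ψ = count-split (λ i → ind-fibres (M i) (Q i) (ψ i))

  switch-count : (M P Q : I → Bool) (φ : I → Bool → Bool → Bool) →
    count (λ i → φ i (P i xor M i) (Q i xor M i)) ≡ count (λ i → φ i (P i) (Q i)) ⇔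
    count (λ i → M i ∧ φ i (not (P i)) (not (Q i))) ≡ count (λ i → M i ∧ φ i (P i) (Q i))
  switch-count M P Q φ = cancel-common-summand (count (λ i → not (M i) ∧ φ i (P i) (Q i)))
    (count-split (λ i → ind-switch (M i) (φ i) (P i) (Q i)))
    (count-split (λ i → ind-partition (M i) (φ i (P i) (Q i))))

  switch-count₁ : (M P : I → Bool) (φ : I → Bool → Bool) →
    count (λ i → φ i (P i xor M i)) ≡ count (λ i → φ i (P i)) ⇔
    count (λ i → M i ∧ φ i (not (P i))) ≡ count (λ i → M i ∧ φ i (P i))
  switch-count₁ M P φ = switch-count M P P (λ i u _ → φ i u)

  balanced-intro : ∀ {M P} → count (λ i → M i ∧ not (P i)) ≡ count (λ i → M i ∧ P i) → Balanced M P
  balanced-intro {M} {P} e = balanced (trans (count-cong (λ i → cong (M i ∧_) (==-false (P i))))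
    (trans e (sym (count-cong (λ i → cong (M i ∧_) (==-true (P i)))))))

  balanced-all : ∀ {M P} → Balanced M P → ∀ t →
    count (λ i → M i ∧ (P i == not t)) ≡ count (λ i → M i ∧ (P i == t))
  balanced-all bal true  = balance bal
  balanced-all bal false = sym (balance bal)

  flip-invariant : ∀ {M P} → Balanced M P → (ψ : Bool → Bool) →
    count (λ i → M i ∧ ψ (not (P i))) ≡ count (λ i → M i ∧ ψ (P i))
  flip-invariant {M} {P} bal ψ with bool-function-cases ψ
  ... | inj₁ ψ∘not≗ψ = count-cong (λ i → cong (M i ∧_) (ψ∘not≗ψ (P i)))
  ... | inj₂ (t , ψ≗==t) = begin
    count (λ i → M i ∧ ψ (not (P i)))
      ≡⟨ count-cong (λ i → cong (M i ∧_) (trans (ψ≗==t (not (P i))) (not-== (P i) t))) ⟩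
    count (λ i → M i ∧ (P i == not t)) ≡⟨ balanced-all bal t ⟩
    count (λ i → M i ∧ (P i == t))     ≡⟨ count-cong (λ i → cong (M i ∧_) (ψ≗==t (P i))) ⟨
    count (λ i → M i ∧ ψ (P i))        ∎

  switch-frequency : ∀ {m M P} → Frequency m P → Frequency m (λ i → P i xor M i) ⇔ Balanced M P
  switch-frequency {m} {M} {P} (zeros , ones) = mk⇔
    (λ (_ , ones′) → balanced-intro (to (switch-count₁ M P (λ _ u → u)) (trans ones′ (sym ones))))
    (λ bal → trans (from (switch-count₁ M P (λ _ → not)) (flip-invariant bal not)) zeros
           , trans (from (switch-count₁ M P (λ _ u → u)) (flip-invariant bal (λ u → u))) ones)

  frequency-cong : ∀ {m P Q} → (∀ i → P i ≡ Q i) → Frequency m P → Frequency m Q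
  frequency-cong P≗Q (zeros , ones) =
    trans (sym (count-cong (λ i → cong not (P≗Q i)))) zeros , trans (sym (count-cong P≗Q)) ones

  balanced-complement : ∀ {M P Q} → Balanced M P → Balanced (λ i → M i ∧ (Q i == true)) P →
    Balanced (λ i → M i ∧ (Q i == false)) P
  balanced-complement {M} {P} {Q} bal balᵗ = balanced (+-cancelˡ-≡ _ _ _ (begin
    countᵗ false + countᶠ false        ≡⟨ count-fibres M Q (λ i _ → P i == false) ⟨
    count (λ i → M i ∧ (P i == false)) ≡⟨ balance bal ⟩
    count (λ i → M i ∧ (P i == true))  ≡⟨ count-fibres M Q (λ i _ → P i == true) ⟩
    countᵗ true + countᶠ true          ≡⟨ cong (_+ countᶠ true) (balance balᵗ) ⟨
    countᵗ false + countᶠ true         ∎))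
    where
    countᵗ countᶠ : Bool → ℕ
    countᵗ u = count (λ i → (M i ∧ (Q i == true)) ∧ (P i == u))
    countᶠ u = count (λ i → (M i ∧ (Q i == false)) ∧ (P i == u))

  aligned-not : ∀ {M P R d} → Aligned M P R d → Aligned M (λ i → not (P i)) (λ i → not (R i)) d
  aligned-not {R = R} {d} al =
    aligned (λ i m → trans (cong not (on-mask al i m)) (not-distribʳ-xor d (R i)))

  aligned-restrict : ∀ {M P R d} (N : I → Bool) → Aligned M P R d → Aligned (λ i → M i ∧ N i) P R d
  aligned-restrict {M} N al = aligned (λ i m → on-mask al i (∧-conicalˡ (M i) (N i) m))

  aligned-count : ∀ {M P R d} → Aligned M P R d → Balanced M R → (ψ : Bool → Bool) →
    count (λ i → M i ∧ ψ (P i)) ≡ count (λ i → M i ∧ ψ (R i))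
  aligned-count {M} {d = false} al bal ψ = count-cong-on M (λ i m → cong ψ (on-mask al i m))
  aligned-count {M} {d = true}  al bal ψ =
    trans (count-cong-on M (λ i m → cong ψ (on-mask al i m))) (flip-invariant bal ψ)

  aligned-balanced : ∀ {M P R d} → Aligned M P R d → Balanced M R → Balanced M P
  aligned-balanced al bal = balanced
    (trans (aligned-count al bal (_== false)) (trans (balance bal) (sym (aligned-count al bal (_== true)))))

  aligned-flip-invariant : ∀ {M P P′ R d d′} → Aligned M P R d → Aligned M P′ R d′ → Balanced M R →
    (χ : Bool → Bool → Bool) →
    count (λ i → M i ∧ χ (not (P i)) (not (P′ i))) ≡ count (λ i → M i ∧ χ (P i) (P′ i))
  aligned-flip-invariant {M} {P} {P′} {R} {d} {d′} al al′ bal χ = begin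
    count (λ i → M i ∧ χ (not (P i)) (not (P′ i)))
      ≡⟨ count-cong-on M (λ i m → cong₂ χ (on-mask (aligned-not al) i m) (on-mask (aligned-not al′) i m)) ⟩
    count (λ i → M i ∧ ψ (not (R i)))  ≡⟨ flip-invariant bal ψ ⟩
    count (λ i → M i ∧ ψ (R i))        ≡⟨ count-cong-on M (λ i m → cong₂ χ (on-mask al i m) (on-mask al′ i m)) ⟨
    count (λ i → M i ∧ χ (P i) (P′ i)) ∎
    where
    ψ : Bool → Bool
    ψ u = χ (d xor u) (d′ xor u)

module Line {n : ℕ} = Counting (countB {n}) countB-cong countB-split
module Cells {n : ℕ} = Counting (λ (p : Fin n × Fin n → Bool) → countCells (λ x y → p (x , y)))
  countCells-cong countCells-split

module _ {n : ℕ} where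

  LinesBalanced : CellSet n → Array n → Set
  LinesBalanced C P =
    (∀ x → Line.Balanced (C x) (P x)) × (∀ y → Line.Balanced (λ x → C x y) (λ x → P x y))

  fibre : CellSet n → Array n → Bool → Fin n × Fin n → Bool
  fibre C Q b z = uncurry C z ∧ (uncurry Q z == b)

  rows-balanced : {C P : Array n} → (∀ x → Line.Balanced (C x) (P x)) → Cells.Balanced (uncurry C) (uncurry P)
  rows-balanced rows = Cells.balanced (cong sum (map-cong (λ x → Line.balance (rows x)) (allFin n)))

  lines-balanced-aligned : {C P Q : Array n} {d : Bool} → (∀ x y → C x y ≡ true → P x y ≡ d xor Q x y) →
    LinesBalanced C Q → LinesBalanced C P
  lines-balanced-aligned {d = d} al (rows , cols) =
    (λ x → Line.aligned-balanced {d = d} (Line.aligned (al x)) (rows x)) ,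
    (λ y → Line.aligned-balanced {d = d} (Line.aligned (λ x → al x y)) (cols y))

  frequency-square-cong : {P Q : Array n} → (∀ x y → P x y ≡ Q x y) →
    IsFrequencySquare n P → IsFrequencySquare n Q
  frequency-square-cong P≗Q (rows , cols) =
    (λ x → Line.frequency-cong (P≗Q x) (rows x)) , (λ y → Line.frequency-cong (λ x → P≗Q x y) (cols y))

  switch-frequency-square : {C P : Array n} → IsFrequencySquare n P →
    IsFrequencySquare n (λ x y → P x y xor C x y) ⇔ LinesBalanced C P
  switch-frequency-square (rows , cols) = mk⇔
    (λ (rows′ , cols′) → (λ x → to (Line.switch-frequency (rows x)) (rows′ x))
                       , (λ y → to (Line.switch-frequency (cols y)) (cols′ y)))
    (λ (rows′ , cols′) → (λ x → from (Line.switch-frequency (rows x)) (rows′ x))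
                       , (λ y → from (Line.switch-frequency (cols y)) (cols′ y)))

  orthogonal-cong : {P P′ Q Q′ : Array n} → (∀ x y → P x y ≡ P′ x y) → (∀ x y → Q x y ≡ Q′ x y) →
    Orthogonal n P Q → Orthogonal n P′ Q′
  orthogonal-cong P≗P′ Q≗Q′ orth a b = trans
    (sym (countCells-cong (λ (x , y) → cong₂ (λ u v → (u == a) ∧ (v == b)) (P≗P′ x y) (Q≗Q′ x y))))
    (orth a b)

  orthogonal-sym : {P Q : Array n} → Orthogonal n P Q → Orthogonal n Q P
  orthogonal-sym {P} {Q} orth a b =
    trans (countCells-cong (λ (x , y) → ∧-comm (Q x y == a) (P x y == b))) (orth b a)

  switch-orthogonal : {C P Q : Array n} → Orthogonal n P Q →
    Orthogonal n (λ x y → P x y xor C x y) Q ⇔ (∀ b → Cells.Balanced (fibre C Q b) (uncurry P))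
  switch-orthogonal {C} {P} {Q} orth = mk⇔
    (λ orth′ b → Cells.balanced (trans
      (countCells-cong (λ (x , y) → cong (fibre C Q b (x , y) ∧_) (sym (not-== (P x y) true))))
      (to (flip-criterion true b) (trans (orth′ true b) (sym (orth true b))))))
    (λ bal a b → trans (from (flip-criterion a b) (Cells.flip-invariant (bal b) (_== a))) (orth a b))
    where
    regroup : (R : Array n) (b : Bool) → countCells (λ x y → C x y ∧ (R x y ∧ (Q x y == b))) ≡
                                         countCells (λ x y → fibre C Q b (x , y) ∧ R x y)
    regroup R b = countCells-cong (λ (x , y) → ∧-regroup (C x y) (R x y) (Q x y == b))
    flip-criterion : ∀ a b →
      countCells (λ x y → ((P x y xor C x y) == a) ∧ (Q x y == b)) ≡
      countCells (λ x y → (P x y == a) ∧ (Q x y == b)) ⇔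
      countCells (λ x y → fibre C Q b (x , y) ∧ (not (P x y) == a)) ≡
      countCells (λ x y → fibre C Q b (x , y) ∧ (P x y == a))
    flip-criterion a b = mk⇔
      (λ e → trans (sym (regroup P̄ b)) (trans (to switching e) (regroup P̂ b)))
      (λ e → from switching (trans (regroup P̄ b) (trans e (sym (regroup P̂ b)))))
      where
      P̂ P̄ : Array n
      P̂ x y = P x y == a
      P̄ x y = not (P x y) == a
      switching : countCells (λ x y → ((P x y xor C x y) == a) ∧ (Q x y == b)) ≡
               countCells (λ x y → (P x y == a) ∧ (Q x y == b)) ⇔
               countCells (λ x y → C x y ∧ ((not (P x y) == a) ∧ (Q x y == b))) ≡
               countCells (λ x y → C x y ∧ ((P x y == a) ∧ (Q x y == b)))
      switching = Cells.switch-count₁ (uncurry C) (uncurry P) (λ (x , y) u → (u == a) ∧ (Q x y == b))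

  switch₂-orthogonal : {C P Q : Array n} → Orthogonal n P Q →
    (∀ a b → countCells (λ x y → C x y ∧ ((not (P x y) == a) ∧ (not (Q x y) == b))) ≡
             countCells (λ x y → C x y ∧ ((P x y == a) ∧ (Q x y == b)))) →
    Orthogonal n (λ x y → P x y xor C x y) (λ x y → Q x y xor C x y)
  switch₂-orthogonal {C} {P} {Q} orth flipped a b = trans
    (from (Cells.switch-count (uncurry C) (uncurry P) (uncurry Q) (λ _ u v → (u == a) ∧ (v == b))) (flipped a b))
    (orth a b)

all-true : {A : Set} (p : A → Bool) → (∀ z → p z ≡ true) → ∀ xs → all p xs ≡ true
all-true p p≡true xs = to T-≡ (all⁻ p (All.universal (λ z → from T-≡ (p≡true z)) xs))

cell∈allCells : ∀ {n} (x y : Fin n) → (x , y) ∈ allCells n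
cell∈allCells {n} x y = ∈-concatMap⁺ (λ x → map (λ y → x , y) (allFin n))
  (Any.map (λ { refl → ∈-map⁺ (λ y → x , y) (∈-allFin y) }) (∈-allFin x))

agreesOn-refl : ∀ {n} (C : CellSet n) (P : Array n) → agreesOn C P P ≡ true
agreesOn-refl {n} C P =
  all-true _ (λ (x , y) → trans (cong (not (C x y) ∨_) (==-refl (P x y))) (∨-zeroʳ _)) (allCells n)

module _ {n : ℕ} {C : CellSet n} {P Q : Array n} where

  agreesOn-sound : T (agreesOn C P Q) → ∀ x y → C x y ≡ true → P x y ≡ Q x y
  agreesOn-sound agree x y c = toWitness (subst (λ b → T (not b ∨ (P x y == Q x y))) c
    (All.lookup (all⁺ _ (allCells n) agree) (cell∈allCells x y)))

  disagreesOn-sound : T (disagreesOn C P Q) → ∀ x y → C x y ≡ true → P x y ≡ not (Q x y)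
  disagreesOn-sound disagree x y c = ¬-not (toWitnessFalse (subst (λ b → T (not b ∨ not (P x y == Q x y))) c
    (All.lookup (all⁺ _ (allCells n) disagree) (cell∈allCells x y))))

  agreesOn-or-disagreesOn : agreesOn C P Q ∨ disagreesOn C P Q ≡ true →
    ∃ λ d → ∀ x y → C x y ≡ true → P x y ≡ d xor Q x y
  agreesOn-or-disagreesOn h with agreesOn C P Q in agree
  ... | true  = false , agreesOn-sound (from T-≡ agree)
  ... | false = true  , disagreesOn-sound (from T-≡ h)

module Trade {k n : ℕ} (F : Fin (suc k) → Array n) (C : CellSet n) where

  F₁ : Array n
  F₁ = F zero

  switched : Fin (suc k) → Bool
  switched i = agreesOn C (F i) F₁ ∨ disagreesOn C (F i) F₁

  G : Fin (suc k) → Array n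
  G = switch F (inducedTuple F C)

  module _ {i : Fin (suc k)} where

    tuple-switched : switched i ≡ true → ∀ x y → inducedTuple F C i x y ≡ C x y
    tuple-switched s x y = cong (λ b → (if b then C else ∅) x y) s

    tuple-unswitched : switched i ≡ false → IsEmpty (inducedTuple F C i)
    tuple-unswitched s x y = cong (λ b → (if b then C else ∅) x y) s

    G-switched : switched i ≡ true → ∀ x y → F i x y xor C x y ≡ G i x y
    G-switched s x y = sym (cong (F i x y xor_) (tuple-switched s x y))

    G-unswitched : switched i ≡ false → ∀ x y → F i x y ≡ G i x y
    G-unswitched s x y = sym (trans (cong (F i x y xor_) (tuple-unswitched s x y)) (xor-identityʳ (F i x y)))

    switched-nonempty : ∀ {x y} → C x y ≡ true → switched i ≡ true → IsEmpty (inducedTuple F C i) → ⊥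
    switched-nonempty {x} {y} c s empty with () ← trans (sym c) (trans (sym (tuple-switched s x y)) (empty x y))

    alignment : switched i ≡ true → ∃ λ d → ∀ x y → C x y ≡ true → F i x y ≡ d xor F₁ x y
    alignment = agreesOn-or-disagreesOn

    cell-alignment : switched i ≡ true → ∃ (Cells.Aligned (uncurry C) (uncurry (F i)) (uncurry F₁))
    cell-alignment s with alignment s
    ... | d , al = d , Cells.aligned (λ (x , y) → al x y)

  switched-F₁ : switched zero ≡ true
  switched-F₁ = cong (_∨ disagreesOn C F₁ F₁) (agreesOn-refl C F₁)

  unswitched-of-empty : ∃₂ (λ x y → C x y ≡ true) → ∀ {j} → IsEmpty (inducedTuple F C j) → switched j ≡ false
  unswitched-of-empty (_ , _ , c) empty = ¬-not (λ s → switched-nonempty c s empty)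

  nontrivial : ∃₂ (λ x y → C x y ≡ true) → ¬ (∀ i → IsEmpty (inducedTuple F C i))
  nontrivial (_ , _ , c) all-empty = switched-nonempty c switched-F₁ (all-empty zero)

  cond1⇔lines-balanced : Cond1 F C ⇔ LinesBalanced C F₁
  cond1⇔lines-balanced = mk⇔
    (λ (rows , cols) → (λ x → Line.balanced (rows x)) , (λ y → Line.balanced (cols y)))
    (λ (rows , cols) → (λ x → Line.balance (rows x)) , (λ y → Line.balance (cols y)))

  cond2⇔fibre-balanced : ∀ j →
    countCells (λ x y → V F C zero true x y ∧ V F C j true x y) ≡
    countCells (λ x y → V F C zero false x y ∧ V F C j true x y) ⇔
    Cells.Balanced (fibre C (F j) true) (uncurry F₁)
  cond2⇔fibre-balanced j = mk⇔
    (λ e → Cells.balanced (trans (sym (regroup false)) (trans (sym e) (regroup true))))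
    (λ bal → trans (regroup true) (trans (sym (Cells.balance bal)) (sym (regroup false))))
    where
    regroup : ∀ u → countCells (λ x y → V F C zero u x y ∧ V F C j true x y) ≡
                    countCells (λ x y → fibre C (F j) true (x , y) ∧ (F₁ x y == u))
    regroup u = countCells-cong (λ (x , y) → ∧-shared-regroup (C x y) (F₁ x y == u) (F j x y == true))

  total-balanced : Cond1 F C → Cells.Balanced (uncurry C) (uncurry F₁)
  total-balanced (rows , _) = rows-balanced (λ x → Line.balanced (rows x))

  fibre-balanced : Cond1 F C → Cond2 F C → ∀ {j} → switched j ≡ false → ∀ b →
    Cells.Balanced (fibre C (F j) b) (uncurry F₁)
  fibre-balanced _     cond2 {j} s true  = to (cond2⇔fibre-balanced j) (cond2 j (tuple-unswitched s))
  fibre-balanced cond1 cond2     s false =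
    Cells.balanced-complement (total-balanced cond1) (fibre-balanced cond1 cond2 s true)

  cond1-of-frequency : IsMOFS (suc k) n F → IsFrequencySquare n (G zero) → Cond1 F C
  cond1-of-frequency (freqF , _) freqG₁ = from cond1⇔lines-balanced (to (switch-frequency-square (freqF zero))
    (frequency-square-cong (λ x y → sym (G-switched switched-F₁ x y)) freqG₁))

  cond2-of-orthogonal : IsMOFS (suc k) n F → ∃₂ (λ x y → C x y ≡ true) →
    (∀ i j → i ≢ j → Orthogonal n (G i) (G j)) → Cond2 F C
  cond2-of-orthogonal (_ , orthF) nonempty orthG j empty = from (cond2⇔fibre-balanced j)
    (to (switch-orthogonal {C = C} {F₁} {F j} (orthF zero j 0≢j))
      (orthogonal-cong (λ x y → sym (G-switched switched-F₁ x y)) (λ x y → sym (G-unswitched sⱼ x y))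
        (orthG zero j 0≢j))
      true)
    where
    sⱼ : switched j ≡ false
    sⱼ = unswitched-of-empty nonempty empty
    0≢j : zero ≢ j
    0≢j refl with () ← trans (sym switched-F₁) sⱼ

  frequency-switched : IsMOFS (suc k) n F → Cond1 F C → ∀ i → IsFrequencySquare n (G i)
  frequency-switched (freqF , _) cond1 i with switched i ≟ true
  ... | no s = frequency-square-cong (G-unswitched (¬-not s)) (freqF i)
  ... | yes s with alignment s
  ...   | d , al = frequency-square-cong (G-switched s) (from (switch-frequency-square (freqF i))
    (lines-balanced-aligned {d = d} al (to cond1⇔lines-balanced cond1)))

  orthogonal-switched-unswitched : Cond1 F C → Cond2 F C → ∀ {i j} → switched i ≡ true → switched j ≡ false →
    Orthogonal n (F i) (F j) → Orthogonal n (G i) (G j)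
  orthogonal-switched-unswitched cond1 cond2 {i} {j} sᵢ sⱼ orth with cell-alignment sᵢ
  ... | _ , al = orthogonal-cong (G-switched sᵢ) (G-unswitched sⱼ)
    (from (switch-orthogonal {C = C} {F i} {F j} orth)
      (λ b → Cells.aligned-balanced (Cells.aligned-restrict _ al) (fibre-balanced cond1 cond2 sⱼ b)))

  orthogonal-switched : IsMOFS (suc k) n F → Cond1 F C → Cond2 F C →
    ∀ i j → i ≢ j → Orthogonal n (G i) (G j)
  orthogonal-switched (_ , orthF) cond1 cond2 i j i≢j with switched i ≟ true | switched j ≟ true
  ... | yes sᵢ | yes sⱼ with cell-alignment sᵢ | cell-alignment sⱼ
  ...   | _ , alᵢ | _ , alⱼ = orthogonal-cong (G-switched sᵢ) (G-switched sⱼ)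
    (switch₂-orthogonal {C = C} {F i} {F j} (orthF i j i≢j)
      (λ a b → Cells.aligned-flip-invariant alᵢ alⱼ (total-balanced cond1) (λ u v → (u == a) ∧ (v == b))))
  orthogonal-switched (_ , orthF) cond1 cond2 i j i≢j | yes sᵢ | no sⱼ =
    orthogonal-switched-unswitched cond1 cond2 sᵢ (¬-not sⱼ) (orthF i j i≢j)
  orthogonal-switched (_ , orthF) cond1 cond2 i j i≢j | no sᵢ | yes sⱼ =
    orthogonal-sym {P = G j} {Q = G i}
      (orthogonal-switched-unswitched cond1 cond2 sⱼ (¬-not sᵢ) (orthF j i (λ j≡i → i≢j (sym j≡i))))
  orthogonal-switched (_ , orthF) cond1 cond2 i j i≢j | no sᵢ | no sⱼ =
    orthogonal-cong (G-unswitched (¬-not sᵢ)) (G-unswitched (¬-not sⱼ)) (orthF i j i≢j)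

theorem4p1 : (k n : ℕ) → 2 ∣ n → (F : Fin (suc k) → Array n) → IsMOFS (suc k) n F →
    (C : CellSet n) → ∃₂ (λ x y → C x y ≡ true) →
    IsTrade (suc k) n F (inducedTuple F C) ⇔ (Cond1 F C × Cond2 F C)
theorem4p1 k n _ F mofs C nonempty = mk⇔
  (λ (_ , freqG , orthG) → cond1-of-frequency mofs (freqG zero) , cond2-of-orthogonal mofs nonempty orthG)
  (λ (cond1 , cond2) → nontrivial nonempty , frequency-switched mofs cond1 , orthogonal-switched mofs cond1 cond2)
  where open Trade F C
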